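{- Let $G$ be a connected graph with vertex set $[n]=\{1,\ldots,n\}$ and diameter at least $2$. (i) Let $F \subseteq [n]$ and let $S$ be a maximum stable set of $G_*^F$. Then there exists a maximum stable set $S^*$ of $G_*^F$ such that $K(S^*)$ is the set of the $|K(S)|$ largest elements of $F$. Moreover, if $\alpha(G^F)< n$, then there exists a maximum stable set $S$ of $G_*^F$ with $K(S)=\varnothing$, and consequently $\alpha(G_*^F)=\alpha(G^F)$. (ii) Let $p\in [n]$. Then $\alpha(G_*^{[p]})= \max \{\alpha(G^{[t]})+p-t : t \in [p]\}$. Moreover, if $\alpha(G^{[t]})=n$ for some $t\in[p]$, then $\chi_{\rho}(G)= n+p - \alpha(G_*^{[p]})$.
   Context: $\alpha$ denotes the stability number. For a graph $G=(V,E)$, a packing $k$-coloring of $G$ is a partition $V_1,\ldots,V_k$ of $V$ such that for every $i\in\{1,\ldots,k\}$, any two distinct vertices $u,v\in V_i$ are at distance at least $i+1$ in $G$; the packing chromatic number $\chi_\rho(G)$ is the smallest such $k$. For integer $k\ge 1$, $G^k$ is the graph on $V(G)$ in which distinct $u,v$ are adjacent iff $d_G(u,v)\le k$ (so $G^1=G$). For $F\subseteq[n]$, $G^F$ is the graph with vertex set $\{(v,k): v\in V(G),\ k\in F\}$ and edge set $$\bigcup_{k\in F}\{((u,k),(v,k)) : (u,v)\in E(G^k)\}\ \cup \bigcup_{j,k\in F,\ j<k}\{((v,j),(v,k)) : v\in V(G)\}.$$ $G_*^F$ is the graph with vertex set $V(G^F)\cup\{(*,k): k\in F\}$ (where $*$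 is a new symbol not in $V(G)$) and edge set $E(G^F)\cup\bigcup_{k\in F}\{((*,k),(v,k)) : v\in V(G)\}$. For $S\subseteq V(G_*^F)$, $K(S)=\{k\in F : (*,k)\in S\}$. For a positive integer $p$, $[p]=\{1,\ldots,p\}$, and $G^{[p]}$, $G_*^{[p]}$ denote $G^F$, $G_*^F$ with $F=[p]$. -}

module Defs where

open import Data.Nat using (ℕ; zero; suc; _≤_; _<_; _+_; _∸_)
open import Data.Nat.Properties using () renaming (_≟_ to _≟ℕ_)
open import Data.Fin using (Fin; toℕ) renaming (_<_ to _<ᶠ_)
import Data.Fin as Fin
import Data.Fin.Subset as Sub
open import Data.Maybe using (Maybe; just; nothing)
import Data.Maybe.Properties as MaybeP
import Data.Product.Properties as ProdP
open import Data.Product using (Σ; ∃; _×_; _,_)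
open import Data.Sum using (_⊎_)
open import Data.Empty using (⊥)
open import Data.Bool using (Bool)
open import Data.List using (List; length)
open import Data.List.Membership.Propositional using (_∈_)
open import Data.List.Relation.Unary.All using (All)
open import Data.List.Relation.Unary.Unique.Propositional using (Unique)
open import Data.Vec using (tabulate)
open import Relation.Nullary using (¬_; Dec; yes; no)
open import Relation.Nullary.Decidable using (isYes)
open import Relation.Binary.PropositionalEquality using (_≡_; _≢_)
open import Relation.Binary.Definitions using (DecidableEquality)

-- Finite simple graphs on the vertex set [n]; vertex  v : Fin n  stands
-- for the integer  toℕ v + 1.

record Graph (n : ℕ) : Set₁ where
  field
    Adj    : Fin n → Fin n → Set
    adj?   : ∀ u v → Dec (Adj u v)
    sym    : ∀ {u v} → Adj u v → Adj v u
    irrefl : ∀ {u} → ¬ Adj u u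
open Graph public

data Within {n : ℕ} (G : Graph n) : ℕ → Fin n → Fin n → Set where
  here : ∀ {k u} → Within G k u u
  step : ∀ {k u w v} → Adj G u w → Within G k w v → Within G (suc k) u v

Connected : ∀ {n} → Graph n → Set
Connected G = ∀ u v → ∃ λ k → Within G k u v

DiamAtLeast2 : ∀ {n} → Graph n → Set
DiamAtLeast2 G = ∃ λ u → ∃ λ v → ¬ Within G 1 u v

record VGraph : Set₁ where
  field
    V   : Set
    InV : V → Set
    E   : V → V → Set
open VGraph public

Stable : (H : VGraph) → List (V H) → Set
Stable H S = Unique S × All (InV H) S
           × (∀ {x y} → x ∈ S → y ∈ S → ¬ E H x y)

MaxStable : (H : VGraph) → List (V H) → Set
MaxStable H S = Stable H S × (∀ T → Stable H T → length T ≤ length S)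

IsAlpha : VGraph → ℕ → Set
IsAlpha H a = (∃ λ S → Stable H S × length S ≡ a)
            × (∀ T → Stable H T → length T ≤ a)

-- Subsets F ⊆ [n] : index  i : Fin n  stands for the integer toℕ i + 1.

-- The k-th power adjacency, k = toℕ i + 1, within layer i, and the
-- edges (v,j)(v,k) between layers.
PowAdj : ∀ {n} → Graph n → (Fin n × Fin n) → (Fin n × Fin n) → Set
PowAdj G (u , i) (v , j) =
  (i ≡ j × u ≢ v × Within G (suc (toℕ i)) u v) ⊎ (u ≡ v × i ≢ j)

Pow : ∀ {n} → Graph n → Sub.Subset n → VGraph
Pow {n} G F = record
  { V   = Fin n × Fin n
  ; InV = λ { (v , i) → i Sub.∈ F }
  ; E   = PowAdj G }

-- vertices of G_*^F : (nothing , i) is (* , k)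
StarAdj : ∀ {n} → Graph n → (Maybe (Fin n) × Fin n) → (Maybe (Fin n) × Fin n) → Set
StarAdj G (just u  , i) (just v  , j) = PowAdj G (u , i) (v , j)
StarAdj G (nothing , i) (just v  , j) = i ≡ j
StarAdj G (just u  , i) (nothing , j) = i ≡ j
StarAdj G (nothing , i) (nothing , j) = ⊥

Star : ∀ {n} → Graph n → Sub.Subset n → VGraph
Star {n} G F = record
  { V   = Maybe (Fin n) × Fin n
  ; InV = λ { (x , i) → i Sub.∈ F }
  ; E   = StarAdj G }

starVtx-≟ : ∀ {n} → DecidableEquality (Maybe (Fin n) × Fin n)
starVtx-≟ = ProdP.≡-dec (MaybeP.≡-dec Fin._≟_) Fin._≟_

_∈?ˢ_ : ∀ {n} (x : Maybe (Fin n) × Fin n) (S : List (Maybe (Fin n) × Fin n)) → Dec (x ∈ S)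
x ∈?ˢ S = Data.List.Membership.DecPropositional._∈?_ starVtx-≟ x S
  where import Data.List.Membership.DecPropositional

K : ∀ {n} → List (Maybe (Fin n) × Fin n) → Sub.Subset n
K S = tabulate (λ i → isYes ((nothing , i) ∈?ˢ S))

LargestOf : ∀ {n} → Sub.Subset n → ℕ → Sub.Subset n → Set
LargestOf F m X = X Sub.⊆ F × Sub.∣ X ∣ ≡ m
                × (∀ i j → i Sub.∈ X → j Sub.∈ F → j Sub.∉ X → j <ᶠ i)

Upto : ∀ {n} → ℕ → Sub.Subset n
Upto t = tabulate (λ i → isYes (suc (toℕ i) Data.Nat.≤? t))
  where import Data.Nat

-- Packing colourings: colour c : Fin k stands for toℕ c + 1.

PackingColoring : ∀ {n} → Graph n → (k : ℕ) → (Fin n → Fin k) → Set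
PackingColoring G k c =
  ∀ u v → u ≢ v → c u ≡ c v → ¬ Within G (suc (toℕ (c u))) u v

PackingColorable : ∀ {n} → Graph n → ℕ → Set
PackingColorable G k = ∃ λ c → PackingColoring G k c

IsPackingChromatic : ∀ {n} → Graph n → ℕ → Set
IsPackingChromatic G k = PackingColorable G k × (∀ j → PackingColorable G j → k ≤ j)

-- (i) In a stable set of G_*^F a star (*,k) excludes every other vertex of layer k.  Exchanging
-- layers y < z, where y carries a star and z does not, keeps a set stable, since the ordinary
-- vertices only move down to a layer of smaller power; each exchange lowers the weight Σ (n − k)
-- over the stars, so the stars end up on the largest elements of F.  If α(G^F) < n, the ordinary
-- vertices of a stable set miss some vertex v of G, and a star (*,k) may be replaced by (v,k);
-- removing the stars one at a time gives α(G_*^F) = α(G^F).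
-- (ii) A maximum stable set of G_*^[p+1] is either starless, hence stable in G^[p+1], or has a
-- star that can be raised to the top layer and deleted; together with adding a star on the top
-- layer this gives α(G_*^[p+1]) = max (α(G_*^[p]) + 1, α(G^[p+1])), which unfolds to the max
-- formula.  A packing k-coloring is a stable set of G^[k] containing every vertex of G, and a
-- maximum stable set of G^[s] becomes one after adding one new layer per uncovered vertex; this
-- gives χ_ρ(G) = n + p − α(G_*^[p]).

module Submission where

open import Defs
open import Data.Nat using (ℕ; _≤_; _<_; _+_; _∸_)
open import Data.Fin using (Fin)
open import Data.Fin.Subset using (Subset; ∣_∣)
open import Data.Maybe using (nothing)
open import Data.Product using (∃; _×_; _,_)
open import Data.List.Membership.Propositional using (_∈_)
open import Relation.Nullary using (¬_)
open import Relation.Binary.PropositionalEquality using (_≡_)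

open import Data.Nat using (zero; suc; _⊔_; z≤n; s≤s; s≤s⁻¹; _≤?_; _<?_)
open import Data.Nat.Properties
open import Data.Nat.Induction using (<-wellFounded)
open import Data.Nat.ListAction using (sum)
open import Data.Nat.Solver using (module +-*-Solver)
open import Data.Bool using (Bool; true; false; T)
open import Data.Bool.Properties using (T-≡)
open import Data.Fin as Fin using (toℕ; fromℕ<)
import Data.Fin.Properties as Fin
open import Data.Fin.Subset using (_⊂_) renaming (_∈_ to _∈ₛ_; _∉_ to _∉ₛ_; _⊆_ to _⊆ₛ_)
open import Data.Fin.Subset.Properties using (p⊂q⇒∣p∣<∣q∣) renaming (_∈?_ to _∈ₛ?_)
open import Data.Fin.Permutation as Perm using (Permutation; _⟨$⟩ʳ_)
open import Data.Fin.Permutation.Components using (transpose)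
open import Data.Maybe using (Maybe; just; is-just)
import Data.Maybe.Properties as Maybe
import Data.Product.Properties as Product
open import Data.Product using (∃₂; proj₁; proj₂)
open import Data.Sum using (_⊎_; inj₁; inj₂)
open import Data.Empty using (⊥-elim)
open import Data.Vec as Vec using (tabulate; lookup)
open import Data.Vec.Properties using (lookup∘tabulate; []=⇒lookup; lookup⇒[]=)
open import Data.List using (List; []; _∷_; _++_; [_]; map; filter; length; allFin)
open import Data.List.Properties using (length-map; length-tabulate; length-++-sucʳ; filter-all)
open import Data.List.Extrema.Nat using (argmax; argmax-all; f[xs]≤f[argmax])
open import Data.List.Relation.Unary.All as All using (All; []; _∷_)
import Data.List.Relation.Unary.All.Properties as All
open import Data.List.Relation.Unary.AllPairs as AllPairs using ([]; _∷_)
open import Data.List.Relation.Unary.Any as Any using (Any; here; there)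
open import Data.List.Relation.Unary.Unique.Propositional using (Unique)
import Data.List.Relation.Unary.Unique.Propositional.Properties as Unique
open import Data.List.Membership.Propositional using (_∉_)
open import Data.List.Membership.Propositional.Properties
open import Data.List.Relation.Binary.Subset.Propositional using (_⊆_)
open import Data.List.Relation.Binary.Permutation.Propositional using (_↭_; ↭-sym; ↭⇒↭ₛ)
open import Data.List.Relation.Binary.Permutation.Propositional.Properties
  using (shift; All-resp-↭; ∈-resp-↭; ↭-length)
import Data.List.Relation.Binary.Permutation.Setoid.Properties as ↭ₛ
import Data.List.Membership.DecPropositional as DecMembership
open import Algebra.Properties.CommutativeMonoid.Sum +-0-commutativeMonoid
  using (sum-permute; sum-cong-≗) renaming (sum to ∑)
open import Function using (_∘_; _$_; mk⇔)
open import Function.Bundles using (Equivalence)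
open import Induction.WellFounded using (Acc; acc)
open import Relation.Nullary using (Dec; does; yes; no; ¬?; contradiction)
open import Relation.Nullary.Decidable
  using (_×-dec_; _⊎-dec_; isYes; isYes≗does; does-⇔; toWitness; fromWitness; T?; dec-true; dec-false; decidable-stable)
open import Relation.Unary using (Decidable)
open import Relation.Binary.Definitions using (DecidableEquality)
open import Relation.Binary.PropositionalEquality as ≡ using (_≢_; refl; trans; cong; cong₂; subst; setoid)

private
  variable
    A B : Set
    n : ℕ

Unique-⊆⇒length≤ : {xs ys : List A} → Unique xs → xs ⊆ ys → length xs ≤ length ys
Unique-⊆⇒length≤ {xs = []} _ _ = z≤n
Unique-⊆⇒length≤ {xs = x ∷ xs} (x∉xs ∷ uxs) xs⊆ys with ∈-∃++ (xs⊆ys (here refl))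
... | ys₁ , ys₂ , refl = begin
  suc (length xs)            ≤⟨ s≤s (Unique-⊆⇒length≤ uxs xs⊆ys₁++ys₂) ⟩
  suc (length (ys₁ ++ ys₂))  ≡⟨ length-++-sucʳ ys₁ x ys₂ ⟨
  length (ys₁ ++ x ∷ ys₂)    ∎
  where
  open ≤-Reasoning
  xs⊆ys₁++ys₂ : xs ⊆ ys₁ ++ ys₂
  xs⊆ys₁++ys₂ {y} y∈xs with ∈-++⁻ ys₁ (xs⊆ys (there y∈xs))
  ... | inj₁ y∈ys₁           = ∈-++⁺ˡ y∈ys₁
  ... | inj₂ (here refl)     = contradiction refl (All.lookup x∉xs y∈xs)
  ... | inj₂ (there y∈ys₂)   = ∈-++⁺ʳ ys₁ y∈ys₂

Unique-map⁺ : ∀ (f : A → B) {xs} → (∀ {x y} → x ∈ xs → y ∈ xs → f x ≡ f y → x ≡ y) →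
              Unique xs → Unique (map f xs)
Unique-map⁺ f {[]} _ [] = []
Unique-map⁺ f {x ∷ xs} inj (x∉xs ∷ uxs) =
  All.map⁺ (All.tabulate λ y∈xs fx≡fy → All.lookup x∉xs y∈xs (inj (here refl) (there y∈xs) fx≡fy))
  ∷ Unique-map⁺ f (λ x∈ y∈ → inj (there x∈) (there y∈)) uxs

∈⇒↭∷ : ∀ {x : A} {xs} → x ∈ xs → ∃ λ ys → xs ↭ x ∷ ys
∈⇒↭∷ x∈xs with ∈-∃++ x∈xs
... | ys₁ , ys₂ , refl = ys₁ ++ ys₂ , shift _ ys₁ ys₂

sum-map-≤ : ∀ (w : A → ℕ) (f : A → A) {xs} → All (λ x → w (f x) ≤ w x) xs →
            sum (map w (map f xs)) ≤ sum (map w xs)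
sum-map-≤ w f []         = z≤n
sum-map-≤ w f (le ∷ les) = +-mono-≤ le (sum-map-≤ w f les)

sum-map-< : ∀ (w : A → ℕ) (f : A → A) {xs} → All (λ x → w (f x) ≤ w x) xs →
            Any (λ x → w (f x) < w x) xs → sum (map w (map f xs)) < sum (map w xs)
sum-map-< w f (_  ∷ les) (here lt)   = +-mono-<-≤ lt (sum-map-≤ w f les)
sum-map-< w f (le ∷ les) (there lts) = +-mono-≤-< le (sum-map-< w f les lts)

sublists : List A → List (List A)
sublists []       = [ [] ]
sublists (x ∷ xs) = sublists xs ++ map (x ∷_) (sublists xs)

filter∈sublists : ∀ {P : A → Set} (P? : Decidable P) xs → filter P? xs ∈ sublists xs
filter∈sublists P? []       = here refl
filter∈sublists P? (x ∷ xs) with P? x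
... | yes _ = ∈-++⁺ʳ (sublists xs) (∈-map⁺ (x ∷_) (filter∈sublists P? xs))
... | no  _ = ∈-++⁺ˡ (filter∈sublists P? xs)

-- Stable sets

module _ {H : VGraph} where

  Stable-[] : Stable H []
  Stable-[] = [] , [] , λ ()

  Stable-map : ∀ {H′ : VGraph} (f : V H → V H′) {S} →
               (∀ {x y} → x ∈ S → y ∈ S → f x ≡ f y → x ≡ y) →
               (∀ {x} → x ∈ S → InV H′ (f x)) →
               (∀ {x y} → x ∈ S → y ∈ S → E H′ (f x) (f y) → E H x y) →
               Stable H S → Stable H′ (map f S)
  Stable-map {H′} f {S} inj inV reflect (uS , _ , indep) =
    Unique-map⁺ f inj uS , All.map⁺ (All.tabulate inV) , indep′
    where
    indep′ : ∀ {a b} → a ∈ map f S → b ∈ map f S → ¬ E H′ a b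
    indep′ a∈ b∈ with ∈-map⁻ f a∈ | ∈-map⁻ f b∈
    ... | x , x∈ , refl | y , y∈ , refl = indep x∈ y∈ ∘ reflect x∈ y∈

  Stable-filter : ∀ {P : V H → Set} (P? : Decidable P) {S} → Stable H S → Stable H (filter P? S)
  Stable-filter P? {S} (uS , inS , indep) =
      Unique.filter⁺ P? uS
    , All.tabulate (All.lookup inS ∘ ⊆S)
    , λ x∈ y∈ → indep (⊆S x∈) (⊆S y∈)
    where
    ⊆S : filter P? S ⊆ S
    ⊆S x∈ = proj₁ (∈-filter⁻ P? {xs = S} x∈)

  Stable-resp-↭ : ∀ {S T} → S ↭ T → Stable H S → Stable H T
  Stable-resp-↭ S↭T (uS , inS , indep) =
      ↭ₛ.Unique-resp-↭ (setoid _) (↭⇒↭ₛ S↭T) uS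
    , All-resp-↭ S↭T inS
    , λ x∈ y∈ → indep (∈-resp-↭ (↭-sym S↭T) x∈) (∈-resp-↭ (↭-sym S↭T) y∈)

  Stable-∷⁻ : ∀ {x S} → Stable H (x ∷ S) → Stable H S
  Stable-∷⁻ (_ ∷ uS , _ ∷ inS , indep) = uS , inS , λ x∈ y∈ → indep (there x∈) (there y∈)

  Stable-∷⁺ : ∀ {x S} → x ∉ S → InV H x → ¬ E H x x →
              (∀ {y} → y ∈ S → ¬ E H x y × ¬ E H y x) → Stable H S → Stable H (x ∷ S)
  Stable-∷⁺ {x} {S} x∉S inx irr indepˣ (uS , inS , indep) =
    (All.tabulate (λ y∈ x≡y → x∉S (subst (_∈ S) (≡.sym x≡y) y∈)) ∷ uS) , inx ∷ inS , indep′
    where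
    indep′ : ∀ {a b} → a ∈ x ∷ S → b ∈ x ∷ S → ¬ E H a b
    indep′ (here refl) (here refl)  = irr
    indep′ (here refl) (there b∈)   = proj₁ (indepˣ b∈)
    indep′ (there a∈)  (here refl)  = proj₂ (indepˣ a∈)
    indep′ (there a∈)  (there b∈)   = indep a∈ b∈

  Stable-remove : ∀ {x S} → Stable H S → x ∈ S →
                  ∃ λ S′ → Stable H S′ × S′ ⊆ S × x ∉ S′ × length S ≡ suc (length S′)
  Stable-remove st x∈S with ∈⇒↭∷ x∈S
  ... | S′ , S↭x∷S′ with Stable-resp-↭ S↭x∷S′ st
  ...   | st′ = S′ , Stable-∷⁻ st′ , ∈-resp-↭ (↭-sym S↭x∷S′) ∘ there
              , Unique.Unique[x∷xs]⇒x∉xs (proj₁ st′) , ↭-length S↭x∷S′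

  IsAlpha-unique : ∀ {a b} → IsAlpha H a → IsAlpha H b → a ≡ b
  IsAlpha-unique ((S , stS , refl) , ≤a) ((T , stT , refl) , ≤b) = ≤-antisym (≤b S stS) (≤a T stT)

  IsAlpha-empty : ∀ {a} → (∀ x → ¬ InV H x) → IsAlpha H a → a ≡ 0
  IsAlpha-empty no-vertex ((S , (_ , inS , _) , ∣S∣≡a) , _) = trans (≡.sym ∣S∣≡a) (empty inS)
    where
    empty : ∀ {S} → All (InV H) S → length S ≡ 0
    empty []        = refl
    empty (inx ∷ _) = contradiction inx (no-vertex _)

module _ (H : VGraph) (_≟_ : DecidableEquality (V H))
         (InV? : Decidable (InV H)) (E? : ∀ x y → Dec (E H x y))
         {vs : List (V H)} (vs-unique : Unique vs) (vs-complete : ∀ {x} → InV H x → x ∈ vs)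
         where

  private
    independent? : ∀ S → Dec (∀ {x y} → x ∈ S → y ∈ S → ¬ E H x y)
    independent? S with All.all? (λ x → All.all? (λ y → ¬? (E? x y)) S) S
    ... | yes all = yes λ x∈ y∈ → All.lookup (All.lookup all x∈) y∈
    ... | no ¬all = no λ indep → ¬all (All.tabulate λ x∈ → All.tabulate λ y∈ → indep x∈ y∈)

  Stable? : Decidable (Stable H)
  Stable? S = AllPairs.allPairs? (λ x y → ¬? (x ≟ y)) S ×-dec All.all? InV? S ×-dec independent? S

  -- Every stable set T is bounded by its trace on vs, which is one of the candidates.
  α-exists : ∃ (IsAlpha H)
  α-exists = length best , (best , best-stable , refl) , best-maximum
    where
    candidates : List (List (V H))
    candidates = filter Stable? (sublists vs)
    best : List (V H)
    best = argmax length [] candidates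
    best-stable : Stable H best
    best-stable = argmax-all length Stable-[]
                    (All.tabulate λ S∈ → proj₂ (∈-filter⁻ Stable? {xs = sublists vs} S∈))
    best-maximum : ∀ T → Stable H T → length T ≤ length best
    best-maximum T (uT , inT , indep) = ≤-trans
        (Unique-⊆⇒length≤ uT λ x∈T → ∈-filter⁺ (_∈? T) (vs-complete (All.lookup inT x∈T)) x∈T)
        (All.lookup (f[xs]≤f[argmax] {f = length} [] candidates)
          (∈-filter⁺ Stable? (filter∈sublists (_∈? T) vs) trace-stable))
      where
      open DecMembership _≟_ using (_∈?_)
      trace⊆T : filter (_∈? T) vs ⊆ T
      trace⊆T x∈ = proj₂ (∈-filter⁻ (_∈? T) {xs = vs} x∈)
      trace-stable : Stable H (filter (_∈? T) vs)
      trace-stable = Unique.filter⁺ (_∈? T) vs-unique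
                   , All.tabulate (All.lookup inT ∘ trace⊆T)
                   , λ x∈ y∈ → indep (trace⊆T x∈) (trace⊆T y∈)

IsMaxShift : (ℕ → ℕ) → ℕ → ℕ → Set
IsMaxShift b p m = (∃ λ t → 1 ≤ t × t ≤ p × m ≡ b t + p ∸ t)
                 × (∀ t → 1 ≤ t → t ≤ p → b t + p ∸ t ≤ m)

+-∸-suc : ∀ b {p t} → t ≤ p → b + suc p ∸ t ≡ suc (b + p ∸ t)
+-∸-suc b {p} {t} t≤p = begin
  b + suc p ∸ t       ≡⟨ +-∸-assoc b (m≤n⇒m≤1+n t≤p) ⟩
  b + (suc p ∸ t)     ≡⟨ cong (b +_) (+-∸-assoc 1 t≤p) ⟩
  b + suc (p ∸ t)     ≡⟨ +-suc b (p ∸ t) ⟩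
  suc (b + (p ∸ t))   ≡⟨ cong suc (+-∸-assoc b t≤p) ⟨
  suc (b + p ∸ t)     ∎
  where open ≡.≡-Reasoning

IsMaxShift-one : ∀ b {m} → m ≡ b 1 → IsMaxShift b 1 m
IsMaxShift-one b {m} m≡b₁ = (1 , ≤-refl , ≤-refl , trans m≡b₁ (≡.sym (m+n∸n≡m (b 1) 1))) , at-most
  where
  at-most : ∀ t → 1 ≤ t → t ≤ 1 → b t + 1 ∸ t ≤ m
  at-most t 1≤t t≤1 with ≤-antisym t≤1 1≤t
  ... | refl = ≤-reflexive (trans (m+n∸n≡m (b 1) 1) (≡.sym m≡b₁))

IsMaxShift-suc : ∀ b {p m m′} → m′ ≡ suc m ⊔ b (suc p) → IsMaxShift b p m → IsMaxShift b (suc p) m′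
IsMaxShift-suc b {p} {m} {m′} m′≡ ((t , 1≤t , t≤p , m≡) , at-most) = witness , at-most′
  where
  witness : ∃ λ t → 1 ≤ t × t ≤ suc p × m′ ≡ b t + suc p ∸ t
  witness with ⊔-sel (suc m) (b (suc p))
  ... | inj₁ ⊔≡1+m = t , 1≤t , m≤n⇒m≤1+n t≤p ,
          trans m′≡ (trans ⊔≡1+m (trans (cong suc m≡) (≡.sym (+-∸-suc (b t) t≤p))))
  ... | inj₂ ⊔≡b = suc p , s≤s z≤n , ≤-refl , trans m′≡ (trans ⊔≡b (≡.sym (m+n∸n≡m (b (suc p)) (suc p))))
  at-most′ : ∀ t → 1 ≤ t → t ≤ suc p → b t + suc p ∸ t ≤ m′
  at-most′ t 1≤t t≤1+p with m≤n⇒m<n∨m≡n t≤1+p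
  ... | inj₁ t<1+p = begin
    b t + suc p ∸ t     ≡⟨ +-∸-suc (b t) (s≤s⁻¹ t<1+p) ⟩
    suc (b t + p ∸ t)   ≤⟨ s≤s (at-most t 1≤t (s≤s⁻¹ t<1+p)) ⟩
    suc m               ≤⟨ m≤m⊔n (suc m) (b (suc p)) ⟩
    suc m ⊔ b (suc p)   ≡⟨ m′≡ ⟨
    m′                  ∎
    where open ≤-Reasoning
  ... | inj₂ refl = begin
    b (suc p) + suc p ∸ suc p  ≡⟨ m+n∸n≡m (b (suc p)) (suc p) ⟩
    b (suc p)                  ≤⟨ m≤n⊔m (suc m) (b (suc p)) ⟩
    suc m ⊔ b (suc p)          ≡⟨ m′≡ ⟨
    m′                         ∎
    where open ≤-Reasoning

IsMaxShift-rec : ∀ (a b : ℕ → ℕ) {p} → a 1 ≡ b 1 →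
  (∀ q → 1 ≤ q → q < p → a (suc q) ≡ suc (a q) ⊔ b (suc q)) → 1 ≤ p → IsMaxShift b p (a p)
IsMaxShift-rec a b {suc zero}    a₁≡b₁ _   _ = IsMaxShift-one b a₁≡b₁
IsMaxShift-rec a b {suc (suc q)} a₁≡b₁ rec _ = IsMaxShift-suc b (rec (suc q) (s≤s z≤n) ≤-refl)
  (IsMaxShift-rec a b a₁≡b₁ (λ q′ 1≤q′ q′<p → rec q′ 1≤q′ (m≤n⇒m≤1+n q′<p)) (s≤s z≤n))

m∸n≤o⇒m∸o≤n : ∀ m n o → m ∸ n ≤ o → m ∸ o ≤ n
m∸n≤o⇒m∸o≤n m n o m∸n≤o = m≤n+o⇒m∸n≤o m o (begin
  m             ≤⟨ m≤n+m∸n m n ⟩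
  n + (m ∸ n)   ≤⟨ +-monoʳ-≤ n m∸n≤o ⟩
  n + o         ≡⟨ +-comm n o ⟩
  o + n         ∎)
  where open ≤-Reasoning

+-∸-complement : ∀ {b n s p} → b ≤ n → s ≤ p → n + p ∸ (b + p ∸ s) ≡ s + (n ∸ b)
+-∸-complement {b} {n} {s} {p} b≤n s≤p = begin
  n + p ∸ (b + p ∸ s)                    ≡⟨ cong (n + p ∸_) (+-∸-assoc b s≤p) ⟩
  n + p ∸ (b + (p ∸ s))                  ≡⟨ cong₂ (λ x y → x + y ∸ (b + r)) (m+[n∸m]≡n b≤n) (m∸n+n≡m s≤p) ⟨
  (b + k) + (r + s) ∸ (b + r)            ≡⟨ cong (_∸ (b + r)) (regroup b k r s) ⟩
  (b + r) + (s + k) ∸ (b + r)            ≡⟨ m+n∸m≡n (b + r) (s + k) ⟩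
  s + k                                  ∎
  where
  open ≡.≡-Reasoning
  k r : ℕ
  k = n ∸ b
  r = p ∸ s
  regroup : ∀ b k r s → (b + k) + (r + s) ≡ (b + r) + (s + k)
  regroup = solve 4 (λ b k r s → (b :+ k) :+ (r :+ s) := (b :+ r) :+ (s :+ k)) refl
    where open +-*-Solver

length-allFin : ∀ n → length (allFin n) ≡ n
length-allFin n = length-tabulate (λ i → i)

Unique⇒length≤ : {xs : List (Fin n)} → Unique xs → length xs ≤ n
Unique⇒length≤ {n} uxs = ≤-trans (Unique-⊆⇒length≤ uxs (λ {x} _ → ∈-allFin x)) (≤-reflexive (length-allFin n))

_∈Fin?_ : (v : Fin n) (xs : List (Fin n)) → Dec (v ∈ xs)
_∈Fin?_ = DecMembership._∈?_ Fin._≟_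

length<⇒∃∉ : (xs : List (Fin n)) → length xs < n → ∃ (_∉ xs)
length<⇒∃∉ {n} xs ∣xs∣<n with Fin.any? (λ v → ¬? (v ∈Fin? xs))
... | yes v∉xs = v∉xs
... | no ∄v∉xs = contradiction ∣xs∣<n $ ≤⇒≯
    $ ≤-trans (≤-reflexive (≡.sym (length-allFin n))) (Unique-⊆⇒length≤ (Unique.allFin⁺ n) allFin⊆xs)
  where
  allFin⊆xs : ∀ {v} → v ∈ allFin n → v ∈ xs
  allFin⊆xs {v} _ = decidable-stable (v ∈Fin? xs) λ v∉xs → ∄v∉xs (v , v∉xs)

Unique∧length≡n⇒∈ : {xs : List (Fin n)} → Unique xs → length xs ≡ n → ∀ v → v ∈ xs
Unique∧length≡n⇒∈ {n} {xs} uxs ∣xs∣≡n v with v ∈Fin? xs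
... | yes v∈xs = v∈xs
... | no v∉xs  = contradiction (Unique⇒length≤ (v∉xs′ ∷ uxs)) (<-irrefl ∣xs∣≡n)
  where
  v∉xs′ : All (v ≢_) xs
  v∉xs′ = All.tabulate λ v′∈ v≡v′ → v∉xs (subst (_∈ xs) (≡.sym v≡v′) v′∈)

∈-tabulate-isYes⁺ : {P : Fin n → Set} (P? : Decidable P) {i : Fin n} → P i → i ∈ₛ tabulate (isYes ∘ P?)
∈-tabulate-isYes⁺ P? {i} Pi =
  lookup⇒[]= i _ (trans (lookup∘tabulate _ i) (Equivalence.to T-≡ (fromWitness Pi)))

∈-tabulate-isYes⁻ : {P : Fin n → Set} (P? : Decidable P) {i : Fin n} → i ∈ₛ tabulate (isYes ∘ P?) → P i
∈-tabulate-isYes⁻ P? {i} i∈ =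
  toWitness (Equivalence.from T-≡ (trans (≡.sym (lookup∘tabulate _ i)) ([]=⇒lookup i∈)))

indicator : Bool → ℕ
indicator true  = 1
indicator false = 0

∣p∣≡∑indicator : (p : Subset n) → ∣ p ∣ ≡ ∑ (indicator ∘ lookup p)
∣p∣≡∑indicator Vec.[]          = refl
∣p∣≡∑indicator (true Vec.∷ p)  = cong suc (∣p∣≡∑indicator p)
∣p∣≡∑indicator (false Vec.∷ p) = ∣p∣≡∑indicator p

∣∣-permute : ∀ {p q : Subset n} (π : Permutation n n) →
             (∀ i → lookup q i ≡ lookup p (π ⟨$⟩ʳ i)) → ∣ q ∣ ≡ ∣ p ∣
∣∣-permute {p = p} {q} π q≗p∘π = begin
  ∣ q ∣                                ≡⟨ ∣p∣≡∑indicator q ⟩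
  ∑ (indicator ∘ lookup q)             ≡⟨ sum-cong-≗ (cong indicator ∘ q≗p∘π) ⟩
  ∑ (indicator ∘ lookup p ∘ (π ⟨$⟩ʳ_)) ≡⟨ sum-permute (indicator ∘ lookup p) π ⟨
  ∑ (indicator ∘ lookup p)             ≡⟨ ∣p∣≡∑indicator p ⟨
  ∣ p ∣                                ∎
  where open ≡.≡-Reasoning

transpose-matchˡ : ∀ (i j : Fin n) → transpose i j i ≡ j
transpose-matchˡ i j rewrite dec-true (i Fin.≟ i) refl = refl

transpose-fix : ∀ (i j : Fin n) {k} → k ≢ i → k ≢ j → transpose i j k ≡ k
transpose-fix i j {k} k≢i k≢j rewrite dec-false (k Fin.≟ i) k≢i | dec-false (k Fin.≟ j) k≢j = refl

transpose-matchʳ : ∀ (i j : Fin n) → transpose i j j ≡ i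
transpose-matchʳ i j = case (j Fin.≟ i)
  where
  case : Dec (j ≡ i) → transpose i j j ≡ i
  case (yes j≡i) rewrite j≡i = transpose-matchˡ i i
  case (no j≢i) rewrite dec-false (j Fin.≟ i) j≢i | dec-true (j Fin.≟ j) refl = refl

transpose-involutive : ∀ (i j : Fin n) k → transpose i j (transpose i j k) ≡ k
transpose-involutive i j k = case (k Fin.≟ i) (k Fin.≟ j)
  where
  case : Dec (k ≡ i) → Dec (k ≡ j) → transpose i j (transpose i j k) ≡ k
  case (yes k≡i) _ rewrite k≡i =
    trans (cong (transpose i j) (transpose-matchˡ i j)) (transpose-matchʳ i j)
  case (no _) (yes k≡j) rewrite k≡j =
    trans (cong (transpose i j) (transpose-matchʳ i j)) (transpose-matchˡ i j)
  case (no k≢i) (no k≢j) =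
    trans (cong (transpose i j) (transpose-fix i j k≢i k≢j)) (transpose-fix i j k≢i k≢j)

transpose-injective : ∀ (i j : Fin n) {k l} → transpose i j k ≡ transpose i j l → k ≡ l
transpose-injective i j {k} {l} eq = begin
  k                               ≡⟨ transpose-involutive i j k ⟨
  transpose i j (transpose i j k) ≡⟨ cong (transpose i j) eq ⟩
  transpose i j (transpose i j l) ≡⟨ transpose-involutive i j l ⟩
  l                               ∎
  where open ≡.≡-Reasoning

TransposeCases : (i j k : Fin n) → Set
TransposeCases i j k =
  (k ≡ i × transpose i j k ≡ j) ⊎ (k ≡ j × transpose i j k ≡ i) ⊎ (k ≢ i × k ≢ j × transpose i j k ≡ k)

transpose-cases : ∀ (i j k : Fin n) → TransposeCases i j k
transpose-cases i j k = case (k Fin.≟ i) (k Fin.≟ j)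
  where
  case : Dec (k ≡ i) → Dec (k ≡ j) → TransposeCases i j k
  case (yes k≡i) _         = inj₁ (k≡i , subst (λ k → transpose i j k ≡ j) (≡.sym k≡i) (transpose-matchˡ i j))
  case (no _)    (yes k≡j) = inj₂ (inj₁ (k≡j , subst (λ k → transpose i j k ≡ i) (≡.sym k≡j) (transpose-matchʳ i j)))
  case (no k≢i)  (no k≢j)  = inj₂ (inj₂ (k≢i , k≢j , transpose-fix i j k≢i k≢j))

-- Graph powers

∈-Upto⁺ : ∀ {t} {i : Fin n} → toℕ i < t → i ∈ₛ Upto t
∈-Upto⁺ {t = t} = ∈-tabulate-isYes⁺ (λ i → suc (toℕ i) ≤? t)

∈-Upto⁻ : ∀ {t} {i : Fin n} → i ∈ₛ Upto t → toℕ i < t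
∈-Upto⁻ {t = t} = ∈-tabulate-isYes⁻ (λ i → suc (toℕ i) ≤? t)

∉-Upto0 : {i : Fin n} → i ∉ₛ Upto 0
∉-Upto0 i∈ with ∈-Upto⁻ {t = 0} i∈
... | ()

∈-K⁺ : ∀ {S} {i : Fin n} → (nothing , i) ∈ S → i ∈ₛ K S
∈-K⁺ {S = S} = ∈-tabulate-isYes⁺ (λ i → (nothing , i) ∈?ˢ S)

∈-K⁻ : ∀ {S} {i : Fin n} → i ∈ₛ K S → (nothing , i) ∈ S
∈-K⁻ {S = S} = ∈-tabulate-isYes⁻ (λ i → (nothing , i) ∈?ˢ S)

lookup-K : ∀ S (i : Fin n) → lookup (K S) i ≡ isYes ((nothing , i) ∈?ˢ S)
lookup-K S = lookup∘tabulate _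

Within-mono : ∀ {G : Graph n} {k k′ u v} → k ≤ k′ → Within G k u v → Within G k′ u v
Within-mono _         here        = here
Within-mono (s≤s k≤k′) (step a w) = step a (Within-mono k≤k′ w)

Within? : (G : Graph n) → ∀ k u v → Dec (Within G k u v)
Within? G k u v with u Fin.≟ v
... | yes refl = yes here
Within? G zero    u v | no u≢v = no λ { here → u≢v refl }
Within? G (suc k) u v | no u≢v with Fin.any? (λ w → adj? G u w ×-dec Within? G k w v)
... | yes (w , a , wk) = yes (step a wk)
... | no ∄w            = no λ { here → u≢v refl ; (step a wk) → ∄w (_ , a , wk) }

PowAdj? : (G : Graph n) → ∀ x y → Dec (PowAdj G x y)
PowAdj? G (u , i) (v , j) =
  (i Fin.≟ j ×-dec ¬? (u Fin.≟ v) ×-dec Within? G (suc (toℕ i)) u v) ⊎-dec (u Fin.≟ v ×-dec ¬? (i Fin.≟ j))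

PowAdj-irrefl : ∀ {G : Graph n} x → ¬ PowAdj G x x
PowAdj-irrefl _ (inj₁ (_ , u≢u , _)) = u≢u refl
PowAdj-irrefl _ (inj₂ (_ , i≢i))     = i≢i refl

StarAdj? : (G : Graph n) → ∀ x y → Dec (StarAdj G x y)
StarAdj? G (just u  , i) (just v  , j) = PowAdj? G (u , i) (v , j)
StarAdj? G (nothing , i) (just v  , j) = i Fin.≟ j
StarAdj? G (just u  , i) (nothing , j) = i Fin.≟ j
StarAdj? G (nothing , i) (nothing , j) = no λ ()

maybeFins : ∀ n → List (Maybe (Fin n))
maybeFins n = nothing ∷ map just (allFin n)

∈-maybeFins : ∀ (x : Maybe (Fin n)) → x ∈ maybeFins n
∈-maybeFins nothing  = here refl
∈-maybeFins (just u) = there (∈-map⁺ just (∈-allFin u))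

maybeFins-unique : ∀ n → Unique (maybeFins n)
maybeFins-unique n =
  All.map⁺ (All.tabulate λ _ ()) ∷ Unique.map⁺ Maybe.just-injective (Unique.allFin⁺ n)

module _ (G : Graph n) where

  α-Pow : (F : Subset n) → ∃ (IsAlpha (Pow G F))
  α-Pow F = α-exists (Pow G F) (Product.≡-dec Fin._≟_ Fin._≟_) (λ (_ , i) → i ∈ₛ? F) (PowAdj? G)
    (Unique.cartesianProduct⁺ (Unique.allFin⁺ n) (Unique.allFin⁺ n))
    (λ {(u , i)} _ → ∈-cartesianProduct⁺ (∈-allFin u) (∈-allFin i))

  α-Star : (F : Subset n) → ∃ (IsAlpha (Star G F))
  α-Star F = α-exists (Star G F) starVtx-≟ (λ (_ , i) → i ∈ₛ? F) (StarAdj? G)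
    (Unique.cartesianProduct⁺ (maybeFins-unique n) (Unique.allFin⁺ n))
    (λ {(x , i)} _ → ∈-cartesianProduct⁺ (∈-maybeFins x) (∈-allFin i))

StarVertex : ℕ → Set
StarVertex n = Maybe (Fin n) × Fin n

toStar : Fin n × Fin n → StarVertex n
toStar (u , i) = just u , i

∗∉map-toStar : ∀ {T : List (Fin n × Fin n)} {i} → (nothing , i) ∉ map toStar T
∗∉map-toStar ∗i∈ with ∈-map⁻ toStar ∗i∈
... | _ , _ , ()

-- The vertex assigned to a star is junk: justVertices only applies fromStar to non-stars.
fromStar : StarVertex n → Fin n × Fin n
fromStar (just u  , i) = u , i
fromStar (nothing , i) = i , i

isJust? : Decidable (λ (x : StarVertex n) → T (is-just (proj₁ x)))
isJust? x = T? (is-just (proj₁ x))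

justVertices : List (StarVertex n) → List (Fin n × Fin n)
justVertices S = map fromStar (filter isJust? S)

∈-justVertices⁺ : ∀ {S} {u i : Fin n} → (just u , i) ∈ S → (u , i) ∈ justVertices S
∈-justVertices⁺ u∈ = ∈-map⁺ fromStar (∈-filter⁺ isJust? u∈ _)

length-justVertices : ∀ {S : List (StarVertex n)} → (∀ {i} → (nothing , i) ∉ S) →
                      length (justVertices S) ≡ length S
length-justVertices {S = S} no∗ =
  trans (length-map fromStar (filter isJust? S)) (cong length (filter-all isJust? (All.tabulate isJust)))
  where
  isJust : ∀ {x} → x ∈ S → T (is-just (proj₁ x))
  isJust {just _  , _} _  = _
  isJust {nothing , _} ∗∈ = no∗ ∗∈

module _ {G : Graph n} where

  star-blocks-layer : ∀ {F S k u} → Stable (Star G F) S → (nothing , k) ∈ S → (just u , k) ∉ S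
  star-blocks-layer (_ , _ , indep) ∗∈ u∈ = indep ∗∈ u∈ refl

  Stable-Star-layers : ∀ {F F′ S} → (∀ {x i} → (x , i) ∈ S → i ∈ₛ F′) →
                       Stable (Star G F) S → Stable (Star G F′) S
  Stable-Star-layers inF′ (uS , _ , indep) = uS , All.tabulate inF′ , indep

  Stable-Pow-layers : ∀ {F F′ T} → (∀ {u i} → (u , i) ∈ T → i ∈ₛ F′) →
                      Stable (Pow G F) T → Stable (Pow G F′) T
  Stable-Pow-layers inF′ (uT , _ , indep) = uT , All.tabulate inF′ , indep

  Stable-toStar : ∀ {F T} → Stable (Pow G F) T → Stable (Star G F) (map toStar T)
  Stable-toStar st@(_ , inT , _) =
    Stable-map toStar (λ { _ _ refl → refl }) (All.lookup inT) (λ _ _ adj → adj) st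

  Stable-justVertices : ∀ {F S} → Stable (Star G F) S → Stable (Pow G F) (justVertices S)
  Stable-justVertices {F} {S} st =
    Stable-map fromStar inj (λ {x} → inF x) (λ {x} {y} → reflect x y) (Stable-filter isJust? st)
    where
    J : List (StarVertex n)
    J = filter isJust? S
    isJust : ∀ {x} → x ∈ J → T (is-just (proj₁ x))
    isJust x∈ = proj₂ (∈-filter⁻ isJust? {xs = S} x∈)
    inj : ∀ {x y} → x ∈ J → y ∈ J → fromStar x ≡ fromStar y → x ≡ y
    inj {just _  , _} {just _  , _} _ _  refl = refl
    inj {nothing , _} x∈ _ = ⊥-elim (isJust x∈)
    inj {just _  , _} {nothing , _} _ y∈ = ⊥-elim (isJust y∈)
    inF : ∀ x → x ∈ J → proj₂ (fromStar x) ∈ₛ F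
    inF (just _  , _) x∈ = All.lookup (proj₁ (proj₂ st)) (proj₁ (∈-filter⁻ isJust? {xs = S} x∈))
    inF (nothing , _) x∈ = ⊥-elim (isJust x∈)
    reflect : ∀ x y → x ∈ J → y ∈ J → PowAdj G (fromStar x) (fromStar y) → StarAdj G x y
    reflect (just _  , _) (just _  , _) _ _ adj = adj
    reflect (nothing , _) _ x∈ _ = ⊥-elim (isJust x∈)
    reflect (just _  , _) (nothing , _) _ y∈ = ⊥-elim (isJust y∈)

  Stable-Pow⇒Unique-proj₁ : ∀ {F T} → Stable (Pow G F) T → Unique (map proj₁ T)
  Stable-Pow⇒Unique-proj₁ {T = T} (uT , _ , indep) = Unique-map⁺ proj₁ inj uT
    where
    inj : ∀ {x y} → x ∈ T → y ∈ T → proj₁ x ≡ proj₁ y → x ≡ y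
    inj {u , i} {_ , j} x∈ y∈ refl with i Fin.≟ j
    ... | yes refl = refl
    ... | no i≢j   = contradiction (inj₂ (refl , i≢j)) (indep x∈ y∈)

  Stable-Pow⇒length≤n : ∀ {F T} → Stable (Pow G F) T → length T ≤ n
  Stable-Pow⇒length≤n {T = T} st =
    ≤-trans (≤-reflexive (≡.sym (length-map proj₁ T))) (Unique⇒length≤ (Stable-Pow⇒Unique-proj₁ st))

-- Raising the stars

relayer : Fin n → Fin n → StarVertex n → StarVertex n
relayer y z (x , i) = x , transpose y z i

relayer-injective : ∀ {y z : Fin n} {a b} → relayer y z a ≡ relayer y z b → a ≡ b
relayer-injective {y = y} {z} {x , i} {x′ , j} eq with cong proj₁ eq | transpose-injective y z {i} {j} (cong proj₂ eq)
... | refl | refl = refl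

module _ {G : Graph n} {F : Subset n} {S} {y z : Fin n} (st : Stable (Star G F) S)
         (∗y∈S : (nothing , y) ∈ S) (∗z∉S : (nothing , z) ∉ S) where

  -- Non-star vertices never sit on layer y, so relayering can only lower them.
  relayer-lowers : toℕ y ≤ toℕ z → ∀ {u i} → (just u , i) ∈ S → toℕ (transpose y z i) ≤ toℕ i
  relayer-lowers y≤z {u} {i} u∈ with transpose-cases y z i
  ... | inj₁ (refl , _)               = contradiction u∈ (star-blocks-layer st ∗y∈S)
  ... | inj₂ (inj₁ (refl , τi≡y))     = ≤-trans (≤-reflexive (cong toℕ τi≡y)) y≤z
  ... | inj₂ (inj₂ (_ , _ , τi≡i))    = ≤-reflexive (cong toℕ τi≡i)

  Stable-relayer : z ∈ₛ F → toℕ y ≤ toℕ z → Stable (Star G F) (map (relayer y z) S)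
  Stable-relayer z∈F y≤z =
    Stable-map (relayer y z) (λ _ _ → relayer-injective) (λ {a} → inF a) (λ {a} {b} → reflect a b) st
    where
    inF : ∀ a → a ∈ S → transpose y z (proj₂ a) ∈ₛ F
    inF (x , i) a∈ with transpose-cases y z i
    ... | inj₁ (_ , τi≡z)               = subst (_∈ₛ F) (≡.sym τi≡z) z∈F
    ... | inj₂ (inj₁ (_ , τi≡y))        = subst (_∈ₛ F) (≡.sym τi≡y) (All.lookup (proj₁ (proj₂ st)) ∗y∈S)
    ... | inj₂ (inj₂ (_ , _ , τi≡i))    = subst (_∈ₛ F) (≡.sym τi≡i) (All.lookup (proj₁ (proj₂ st)) a∈)
    reflect : ∀ a b → a ∈ S → b ∈ S → StarAdj G (relayer y z a) (relayer y z b) → StarAdj G a b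
    reflect (just u , i) (just v , j) u∈ _ (inj₁ (τi≡τj , u≢v , near)) with transpose-injective y z {i} {j} τi≡τj
    ... | refl = inj₁ (refl , u≢v , Within-mono (s≤s (relayer-lowers y≤z u∈)) near)
    reflect (just u , i) (just v , j) _ _ (inj₂ (u≡v , τi≢τj)) = inj₂ (u≡v , τi≢τj ∘ cong (transpose y z))
    reflect (nothing , i) (just v  , j) _ _ τi≡τj = transpose-injective y z {i} {j} τi≡τj
    reflect (just u  , i) (nothing , j) _ _ τi≡τj = transpose-injective y z {i} {j} τi≡τj
    reflect (nothing , i) (nothing , j) _ _ ()

lookup-K-relayer : ∀ (y z : Fin n) S i → lookup (K (map (relayer y z) S)) i ≡ lookup (K S) (transpose y z i)
lookup-K-relayer y z S i = begin
  lookup (K (map (relayer y z) S)) i            ≡⟨ lookup-K (map (relayer y z) S) i ⟩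
  isYes ((nothing , i) ∈?ˢ map (relayer y z) S) ≡⟨ isYes≗does _ ⟩
  does ((nothing , i) ∈?ˢ map (relayer y z) S)  ≡⟨ does-⇔ (mk⇔ to from) ((nothing , i) ∈?ˢ _)
                                                                         ((nothing , transpose y z i) ∈?ˢ S) ⟩
  does ((nothing , transpose y z i) ∈?ˢ S)      ≡⟨ isYes≗does _ ⟨
  isYes ((nothing , transpose y z i) ∈?ˢ S)     ≡⟨ lookup-K S (transpose y z i) ⟨
  lookup (K S) (transpose y z i)                ∎
  where
  open ≡.≡-Reasoning
  to : (nothing , i) ∈ map (relayer y z) S → (nothing , transpose y z i) ∈ S
  to ∗i∈ with ∈-map⁻ (relayer y z) ∗i∈
  ... | (_ , j) , ∗j∈ , refl = subst (λ k → (nothing , k) ∈ S) (≡.sym (transpose-involutive y z j)) ∗j∈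
  from : (nothing , transpose y z i) ∈ S → (nothing , i) ∈ map (relayer y z) S
  from ∗τi∈ = subst (λ k → (nothing , k) ∈ map (relayer y z) S) (transpose-involutive y z i)
                (∈-map⁺ (relayer y z) ∗τi∈)

∣K∣-relayer : ∀ (y z : Fin n) S → ∣ K (map (relayer y z) S) ∣ ≡ ∣ K S ∣
∣K∣-relayer y z S = ∣∣-permute {p = K S} {q = K (map (relayer y z) S)} (Perm.transpose y z) (lookup-K-relayer y z S)

starWeight : StarVertex n → ℕ
starWeight {n} (nothing , i) = n ∸ toℕ i
starWeight     (just _  , _) = 0

relayer-decreases-weight : ∀ {S} {y z : Fin n} → (nothing , z) ∉ S → toℕ y < toℕ z →
    All (λ a → starWeight (relayer y z a) ≤ starWeight a) S
  × starWeight (relayer y z (nothing , y)) < starWeight (nothing , y)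
relayer-decreases-weight {n} {S} {y} {z} ∗z∉S y<z = All.tabulate (λ {a} → weight-≤ a) , weight-<
  where
  weight-< : starWeight (relayer y z (nothing , y)) < starWeight (nothing , y)
  weight-< rewrite transpose-matchˡ y z = ∸-monoʳ-< y<z (<⇒≤ (Fin.toℕ<n z))
  weight-≤ : ∀ a → a ∈ S → starWeight (relayer y z a) ≤ starWeight a
  weight-≤ (just _ , _) _ = z≤n
  weight-≤ (nothing , i) ∗i∈ with transpose-cases y z i
  ... | inj₁ (refl , _)            = <⇒≤ weight-<
  ... | inj₂ (inj₁ (refl , _))     = contradiction ∗i∈ ∗z∉S
  ... | inj₂ (inj₂ (_ , _ , τi≡i)) = ≤-reflexive (cong (λ k → n ∸ toℕ k) τi≡i)

module _ {G : Graph n} {F : Subset n} where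

  Inversion : List (StarVertex n) → Set
  Inversion S = ∃₂ λ y z → (nothing , y) ∈ S × z ∈ₛ F × (nothing , z) ∉ S × toℕ y < toℕ z

  inversion? : ∀ S → Dec (Inversion S)
  inversion? S = Fin.any? λ y → Fin.any? λ z →
    (nothing , y) ∈?ˢ S ×-dec z ∈ₛ? F ×-dec ¬? ((nothing , z) ∈?ˢ S) ×-dec toℕ y <? toℕ z

  ¬Inversion⇒LargestOf : ∀ {S} → Stable (Star G F) S → ¬ Inversion S → LargestOf F ∣ K S ∣ (K S)
  ¬Inversion⇒LargestOf {S} (_ , inS , _) no-inversion = K⊆F , refl , above
    where
    K⊆F : ∀ {i} → i ∈ₛ K S → i ∈ₛ F
    K⊆F i∈K = All.lookup inS (∈-K⁻ i∈K)
    above : ∀ i j → i ∈ₛ K S → j ∈ₛ F → j ∉ₛ K S → toℕ j < toℕ i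
    above i j i∈K j∈F j∉K with toℕ i <? toℕ j
    ... | yes i<j = contradiction (i , j , ∈-K⁻ i∈K , j∈F , j∉K ∘ ∈-K⁺ , i<j) no-inversion
    ... | no i≮j  = ≤∧≢⇒< (≮⇒≥ i≮j) λ j≡i →
                      j∉K (subst (_∈ₛ K S) (Fin.toℕ-injective (≡.sym j≡i)) i∈K)

  resolve-inversion : ∀ {S} → Stable (Star G F) S → Inversion S →
    ∃ λ S′ → Stable (Star G F) S′ × length S′ ≡ length S × ∣ K S′ ∣ ≡ ∣ K S ∣
           × sum (map starWeight S′) < sum (map starWeight S)
  resolve-inversion {S} st (y , z , ∗y∈S , z∈F , ∗z∉S , y<z) =
      map (relayer y z) S
    , Stable-relayer st ∗y∈S ∗z∉S z∈F (<⇒≤ y<z)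
    , length-map (relayer y z) S
    , ∣K∣-relayer y z S
    , sum-map-< starWeight (relayer y z) weights-≤ (Any.map (λ { refl → weight-< }) ∗y∈S)
    where
    weights-≤ : All (λ a → starWeight (relayer y z a) ≤ starWeight a) S
    weights-≤ = proj₁ (relayer-decreases-weight ∗z∉S y<z)
    weight-< : starWeight (relayer y z (nothing , y)) < starWeight (nothing , y)
    weight-< = proj₂ (relayer-decreases-weight {S = S} ∗z∉S y<z)

  stars-on-top : ∀ {S} → Stable (Star G F) S →
    ∃ λ S* → Stable (Star G F) S* × length S* ≡ length S × LargestOf F ∣ K S ∣ (K S*)
  stars-on-top {S} st = go st (<-wellFounded _)
    where
    go : ∀ {S} → Stable (Star G F) S → Acc _<_ (sum (map starWeight S)) →
         ∃ λ S* → Stable (Star G F) S* × length S* ≡ length S × LargestOf F ∣ K S ∣ (K S*)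
    go {S} st (acc smaller) with inversion? S
    ... | no no-inversion = S , st , refl , ¬Inversion⇒LargestOf st no-inversion
    ... | yes inversion with resolve-inversion st inversion
    ...   | S′ , st′ , ∣S′∣≡∣S∣ , ∣K′∣≡∣K∣ , lighter with go st′ (smaller lighter)
    ...     | S* , st* , ∣S*∣≡∣S′∣ , largest =
        S* , st* , trans ∣S*∣≡∣S′∣ ∣S′∣≡∣S∣
      , subst (λ m → LargestOf F m (K S*)) ∣K′∣≡∣K∣ largest

  MaxStable-largest-stars : ∀ S → MaxStable (Star G F) S →
    ∃ λ S* → MaxStable (Star G F) S* × LargestOf F ∣ K S ∣ (K S*)
  MaxStable-largest-stars S (st , maximum) with stars-on-top st
  ... | S* , st* , ∣S*∣≡∣S∣ , largest =
    S* , (st* , λ T stT → subst (length T ≤_) (≡.sym ∣S*∣≡∣S∣) (maximum T stT)) , largest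

-- Removing the stars

module _ {G : Graph n} {F : Subset n} {a} (α≡a : IsAlpha (Pow G F) a) (a<n : a < n) where

  unused-vertex : ∀ {S} → Stable (Star G F) S → ∃ λ v → ∀ j → (just v , j) ∉ S
  unused-vertex {S} st with length<⇒∃∉ (map proj₁ (justVertices S)) ∣justVertices∣<n
    where
    ∣justVertices∣<n : length (map proj₁ (justVertices S)) < n
    ∣justVertices∣<n = begin-strict
      length (map proj₁ (justVertices S)) ≡⟨ length-map proj₁ (justVertices S) ⟩
      length (justVertices S)             ≤⟨ proj₂ α≡a _ (Stable-justVertices st) ⟩
      a                                   <⟨ a<n ⟩
      n                                   ∎
      where open ≤-Reasoning
  ... | v , v∉ = v , λ j v∈S → v∉ (∈-map⁺ proj₁ (∈-justVertices⁺ v∈S))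

  replace-star : ∀ {S k} → Stable (Star G F) S → (nothing , k) ∈ S →
    ∃ λ S′ → Stable (Star G F) S′ × length S′ ≡ length S × K S′ ⊂ K S
  replace-star {S} {k} st ∗k∈S with unused-vertex st | Stable-remove st ∗k∈S
  ... | v , v-unused | S″ , st″ , S″⊆S , ∗k∉S″ , ∣S∣≡1+∣S″∣ =
      (just v , k) ∷ S″
    , Stable-∷⁺ (λ vk∈ → v-unused k (S″⊆S vk∈)) (All.lookup (proj₁ (proj₂ st)) ∗k∈S)
                (PowAdj-irrefl (v , k)) (λ x∈ → from-vk x∈ , to-vk x∈) st″
    , ≡.sym ∣S∣≡1+∣S″∣
    , K′⊆K , k , ∈-K⁺ ∗k∈S , ∗k∉K′
    where
    from-vk : ∀ {x} → x ∈ S″ → ¬ StarAdj G (just v , k) x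
    from-vk {just u  , j} u∈ (inj₁ (refl , _)) = star-blocks-layer st ∗k∈S (S″⊆S u∈)
    from-vk {just u  , j} u∈ (inj₂ (refl , _)) = v-unused j (S″⊆S u∈)
    from-vk {nothing , j} ∗j∈ refl             = ∗k∉S″ ∗j∈
    to-vk : ∀ {x} → x ∈ S″ → ¬ StarAdj G x (just v , k)
    to-vk {just u  , j} u∈ (inj₁ (refl , _)) = star-blocks-layer st ∗k∈S (S″⊆S u∈)
    to-vk {just u  , j} u∈ (inj₂ (refl , _)) = v-unused j (S″⊆S u∈)
    to-vk {nothing , j} ∗j∈ refl             = ∗k∉S″ ∗j∈
    K′⊆K : K ((just v , k) ∷ S″) ⊆ₛ K S
    K′⊆K i∈ with ∈-K⁻ i∈
    ... | there ∗i∈S″ = ∈-K⁺ (S″⊆S ∗i∈S″)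
    ∗k∉K′ : k ∉ₛ K ((just v , k) ∷ S″)
    ∗k∉K′ k∈ with ∈-K⁻ k∈
    ... | there ∗k∈S″ = ∗k∉S″ ∗k∈S″

  Stable-Star⇒length≤ : ∀ {S} → Stable (Star G F) S → length S ≤ a
  Stable-Star⇒length≤ st = go st (<-wellFounded _)
    where
    go : ∀ {S} → Stable (Star G F) S → Acc _<_ ∣ K S ∣ → length S ≤ a
    go {S} st (acc fewer) with Fin.any? (λ k → (nothing , k) ∈?ˢ S)
    ... | yes (k , ∗k∈S) with replace-star st ∗k∈S
    ...   | S′ , st′ , ∣S′∣≡∣S∣ , K′⊂K =
      subst (_≤ a) ∣S′∣≡∣S∣ (go st′ (fewer (p⊂q⇒∣p∣<∣q∣ K′⊂K)))
    go {S} st _ | no no-star = subst (_≤ a) (length-justVertices λ ∗i∈ → no-star (_ , ∗i∈))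
                                 (proj₂ α≡a _ (Stable-justVertices st))

  IsAlpha-Star : IsAlpha (Star G F) a
  IsAlpha-Star with proj₁ α≡a
  ... | T , stT , ∣T∣≡a =
    (map toStar T , Stable-toStar stT , trans (length-map toStar T) ∣T∣≡a) , λ _ → Stable-Star⇒length≤

  starless-MaxStable : ∃ λ S → MaxStable (Star G F) S × (∀ i → (nothing , i) ∉ S)
  starless-MaxStable with proj₁ α≡a
  ... | T , stT , ∣T∣≡a =
      map toStar T
    , ( Stable-toStar stT
      , λ _ st → subst (_ ≤_) (≡.sym (trans (length-map toStar T) ∣T∣≡a)) (Stable-Star⇒length≤ st))
    , λ _ → ∗∉map-toStar

-- Stars on the layers [p]

module _ (G : Graph n) where

  abstract
    αᴾ αˢ : ℕ → ℕ
    αᴾ t = proj₁ (α-Pow G (Upto t))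
    αˢ t = proj₁ (α-Star G (Upto t))

    αᴾ-isAlpha : ∀ t → IsAlpha (Pow G (Upto t)) (αᴾ t)
    αᴾ-isAlpha t = proj₂ (α-Pow G (Upto t))

    αˢ-isAlpha : ∀ t → IsAlpha (Star G (Upto t)) (αˢ t)
    αˢ-isAlpha t = proj₂ (α-Star G (Upto t))

  Stable-Pow-extend : ∀ {s T} → s < n → length T < n → Stable (Pow G (Upto s)) T →
    ∃ λ T′ → Stable (Pow G (Upto (suc s))) T′ × length T′ ≡ suc (length T)
  Stable-Pow-extend {s} {T} s<n ∣T∣<n st@(_ , inT , _)
    with length<⇒∃∉ (map proj₁ T) (subst (_< n) (≡.sym (length-map proj₁ T)) ∣T∣<n)
  ... | v , v∉T = (v , top) ∷ T , Stable-∷⁺ vtop∉T (∈-Upto⁺ (s≤s (≤-reflexive top≡s))) (PowAdj-irrefl _)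
                                   (λ u∈ → from-vtop u∈ , to-vtop u∈) (Stable-Pow-layers below-suc st) , refl
    where
    top : Fin n
    top = fromℕ< s<n
    top≡s : toℕ top ≡ s
    top≡s = Fin.toℕ-fromℕ< s<n
    below-suc : ∀ {u i} → (u , i) ∈ T → i ∈ₛ Upto (suc s)
    below-suc u∈ = ∈-Upto⁺ (m≤n⇒m≤1+n (∈-Upto⁻ (All.lookup inT u∈)))
    top∉T : ∀ {u} → (u , top) ∉ T
    top∉T u∈ = <-irrefl top≡s (∈-Upto⁻ (All.lookup inT u∈))
    vtop∉T : (v , top) ∉ T
    vtop∉T v∈ = v∉T (∈-map⁺ proj₁ v∈)
    from-vtop : ∀ {x} → x ∈ T → ¬ PowAdj G (v , top) x
    from-vtop u∈ (inj₁ (refl , _)) = top∉T u∈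
    from-vtop u∈ (inj₂ (refl , _)) = v∉T (∈-map⁺ proj₁ u∈)
    to-vtop : ∀ {x} → x ∈ T → ¬ PowAdj G x (v , top)
    to-vtop u∈ (inj₁ (refl , _)) = top∉T u∈
    to-vtop u∈ (inj₂ (refl , _)) = v∉T (∈-map⁺ proj₁ u∈)

  Stable-Pow-extend* : ∀ k {s T} → s + k ≤ n → length T + k ≤ n → Stable (Pow G (Upto s)) T →
    ∃ λ T′ → Stable (Pow G (Upto (s + k))) T′ × length T′ ≡ length T + k
  Stable-Pow-extend* zero {s} {T} _ _ st =
    T , subst (λ t → Stable (Pow G (Upto t)) T) (≡.sym (+-identityʳ s)) st , ≡.sym (+-identityʳ _)
  Stable-Pow-extend* (suc k) {s} {T} s+k<n ∣T∣+k<n st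
    with Stable-Pow-extend (≤-trans (s≤s (m≤m+n s k)) (subst (_≤ n) (+-suc s k) s+k<n))
                           (≤-trans (s≤s (m≤m+n _ k)) (subst (_≤ n) (+-suc _ k) ∣T∣+k<n)) st
  ... | T₁ , st₁ , ∣T₁∣≡ with Stable-Pow-extend* k (subst (_≤ n) (+-suc s k) s+k<n)
                                (subst (_≤ n) (trans (+-suc _ k) (cong (_+ k) (≡.sym ∣T₁∣≡))) ∣T∣+k<n) st₁
  ...   | T′ , st′ , ∣T′∣≡ =
    T′ , subst (λ t → Stable (Pow G (Upto t)) T′) (≡.sym (+-suc s k)) st′
       , trans ∣T′∣≡ (trans (cong (_+ k) ∣T₁∣≡) (≡.sym (+-suc _ k)))

  αᴾ≤n : ∀ t → αᴾ t ≤ n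
  αᴾ≤n t with proj₁ (αᴾ-isAlpha t)
  ... | T , st , ∣T∣≡ = subst (_≤ n) ∣T∣≡ (Stable-Pow⇒length≤n st)

  αᴾ-suc-≥ : ∀ {s} → s < n → αᴾ s < n → suc (αᴾ s) ≤ αᴾ (suc s)
  αᴾ-suc-≥ {s} s<n αᴾs<n with proj₁ (αᴾ-isAlpha s)
  ... | T , st , ∣T∣≡ with Stable-Pow-extend s<n (subst (_< n) (≡.sym ∣T∣≡) αᴾs<n) st
  ...   | T′ , st′ , ∣T′∣≡ =
    subst (_≤ αᴾ (suc s)) (trans ∣T′∣≡ (cong suc ∣T∣≡)) (proj₂ (αᴾ-isAlpha (suc s)) T′ st′)

  αᴾ-zero : αᴾ 0 ≡ 0
  αᴾ-zero = IsAlpha-empty (λ _ → ∉-Upto0) (αᴾ-isAlpha 0)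

  αˢ-zero : αˢ 0 ≡ 0
  αˢ-zero = IsAlpha-empty (λ _ → ∉-Upto0) (αˢ-isAlpha 0)

  IsAlpha-Pow≤IsAlpha-Star : ∀ {F a b} → IsAlpha (Pow G F) b → IsAlpha (Star G F) a → b ≤ a
  IsAlpha-Pow≤IsAlpha-Star ((T , st , refl) , _) (_ , ≤a) =
    subst (_≤ _) (length-map toStar T) (≤a _ (Stable-toStar st))

  αˢ-suc-≥ : ∀ {p} → p < n → suc (αˢ p) ≤ αˢ (suc p)
  αˢ-suc-≥ {p} p<n with proj₁ (αˢ-isAlpha p)
  ... | S , st@(_ , inS , _) , ∣S∣≡ = subst (_≤ αˢ (suc p)) (cong suc ∣S∣≡) $
    proj₂ (αˢ-isAlpha (suc p)) ((nothing , top) ∷ S)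
        (Stable-∷⁺ top∉S (∈-Upto⁺ (s≤s (≤-reflexive top≡p))) (λ ()) (λ x∈ → from-∗top x∈ , to-∗top x∈)
                   (Stable-Star-layers below-suc st))
    where
    top : Fin n
    top = fromℕ< p<n
    top≡p : toℕ top ≡ p
    top≡p = Fin.toℕ-fromℕ< p<n
    below-suc : ∀ {x i} → (x , i) ∈ S → i ∈ₛ Upto (suc p)
    below-suc x∈ = ∈-Upto⁺ (m≤n⇒m≤1+n (∈-Upto⁻ (All.lookup inS x∈)))
    top∉S : ∀ {x} → (x , top) ∉ S
    top∉S x∈ = <-irrefl top≡p (∈-Upto⁻ (All.lookup inS x∈))
    from-∗top : ∀ {x} → x ∈ S → ¬ StarAdj G (nothing , top) x
    from-∗top {just _ , _} x∈ refl = top∉S x∈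
    to-∗top : ∀ {x} → x ∈ S → ¬ StarAdj G x (nothing , top)
    to-∗top {just _ , _} x∈ refl = top∉S x∈

  raise-star : ∀ {F S k z} → Stable (Star G F) S → (nothing , k) ∈ S → z ∈ₛ F → toℕ k ≤ toℕ z →
    ∃ λ S′ → Stable (Star G F) S′ × length S′ ≡ length S × (nothing , z) ∈ S′
  raise-star {S = S} {k} {z} st ∗k∈S z∈F k≤z with (nothing , z) ∈?ˢ S
  ... | yes ∗z∈S = S , st , refl , ∗z∈S
  ... | no ∗z∉S  = map (relayer k z) S , Stable-relayer st ∗k∈S ∗z∉S z∈F k≤z , length-map (relayer k z) S
                 , subst (λ i → (nothing , i) ∈ map (relayer k z) S) (transpose-matchˡ k z)
                         (∈-map⁺ (relayer k z) ∗k∈S)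

  drop-top-star : ∀ {p S} (top : Fin n) → toℕ top ≡ p → Stable (Star G (Upto (suc p))) S → (nothing , top) ∈ S →
    ∃ λ S′ → Stable (Star G (Upto p)) S′ × length S ≡ suc (length S′)
  drop-top-star {p} top top≡p st@(_ , inS , _) ∗top∈S with Stable-remove st ∗top∈S
  ... | S′ , st′ , S′⊆S , ∗top∉S′ , ∣S∣≡ = S′ , Stable-Star-layers below st′ , ∣S∣≡
    where
    below : ∀ {x i} → (x , i) ∈ S′ → i ∈ₛ Upto p
    below {x} {i} x∈ with i Fin.≟ top
    ... | no i≢top = ∈-Upto⁺ (≤∧≢⇒< (s≤s⁻¹ (∈-Upto⁻ (All.lookup inS (S′⊆S x∈))))
                                     (λ i≡p → i≢top (Fin.toℕ-injective (trans i≡p (≡.sym top≡p)))))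
    below {nothing} x∈ | yes refl = contradiction x∈ ∗top∉S′
    below {just _}  x∈ | yes refl = contradiction (S′⊆S x∈) (star-blocks-layer st ∗top∈S)

  αˢ-suc-≤ : ∀ {p} → p < n → αˢ (suc p) ≤ suc (αˢ p) ⊔ αᴾ (suc p)
  αˢ-suc-≤ {p} p<n with proj₁ (αˢ-isAlpha (suc p))
  ... | S , st@(_ , inS , _) , ∣S∣≡ with Fin.any? (λ k → (nothing , k) ∈?ˢ S)
  ...   | no no-star = ≤-trans (≤-reflexive (≡.sym ∣S∣≡)) $ ≤-trans
          (≤-reflexive (≡.sym (length-justVertices λ ∗i∈ → no-star (_ , ∗i∈))))
          (≤-trans (proj₂ (αᴾ-isAlpha (suc p)) _ (Stable-justVertices st)) (m≤n⊔m _ _))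
  ...   | yes (k , ∗k∈S) with raise-star st ∗k∈S (∈-Upto⁺ (s≤s (≤-reflexive top≡p))) k≤top
    where
    top : Fin n
    top = fromℕ< p<n
    top≡p : toℕ top ≡ p
    top≡p = Fin.toℕ-fromℕ< p<n
    k≤top : toℕ k ≤ toℕ top
    k≤top = subst (toℕ k ≤_) (≡.sym top≡p) (s≤s⁻¹ (∈-Upto⁻ (All.lookup inS ∗k∈S)))
  ...     | S₁ , st₁ , ∣S₁∣≡ , ∗top∈S₁ with drop-top-star _ (Fin.toℕ-fromℕ< p<n) st₁ ∗top∈S₁
  ...       | S′ , st′ , ∣S₁∣≡1+∣S′∣ = begin
    αˢ (suc p)              ≡⟨ trans (≡.sym ∣S∣≡) (trans (≡.sym ∣S₁∣≡) ∣S₁∣≡1+∣S′∣) ⟩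
    suc (length S′)         ≤⟨ s≤s (proj₂ (αˢ-isAlpha p) S′ st′) ⟩
    suc (αˢ p)              ≤⟨ m≤m⊔n (suc (αˢ p)) (αᴾ (suc p)) ⟩
    suc (αˢ p) ⊔ αᴾ (suc p) ∎
    where open ≤-Reasoning

  αˢ-suc : ∀ {p} → p < n → αˢ (suc p) ≡ suc (αˢ p) ⊔ αᴾ (suc p)
  αˢ-suc p<n = ≤-antisym (αˢ-suc-≤ p<n)
    (⊔-lub (αˢ-suc-≥ p<n) (IsAlpha-Pow≤IsAlpha-Star (αᴾ-isAlpha _) (αˢ-isAlpha _)))

  αˢ-one : 0 < n → αˢ 1 ≡ αᴾ 1
  αˢ-one 0<n = trans (αˢ-suc 0<n) (trans (cong (λ m → suc m ⊔ αᴾ 1) αˢ-zero) (m≤n⇒m⊔n≡n 1≤αᴾ₁))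
    where
    1≤αᴾ₁ : 1 ≤ αᴾ 1
    1≤αᴾ₁ = subst (λ m → suc m ≤ αᴾ 1) αᴾ-zero (αᴾ-suc-≥ 0<n (subst (_< n) (≡.sym αᴾ-zero) 0<n))

  αˢ-IsMaxShift : ∀ {p} → 1 ≤ p → p ≤ n → IsMaxShift αᴾ p (αˢ p)
  αˢ-IsMaxShift 1≤p p≤n = IsMaxShift-rec αˢ αᴾ (αˢ-one (≤-trans 1≤p p≤n))
    (λ q _ q<p → αˢ-suc (<-≤-trans q<p p≤n)) 1≤p

  full⇒colorable : ∀ {c T} → Stable (Pow G (Upto c)) T → length T ≡ n → PackingColorable G c
  full⇒colorable {c} {T} st@(_ , inT , indep) ∣T∣≡n = color , packing
    where
    covers : ∀ v → ∃ λ i → (v , i) ∈ T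
    covers v
      with ∈-map⁻ proj₁ (Unique∧length≡n⇒∈ (Stable-Pow⇒Unique-proj₁ st) (trans (length-map proj₁ T) ∣T∣≡n) v)
    ... | (_ , i) , v∈ , refl = i , v∈
    layer : Fin n → Fin n
    layer v = proj₁ (covers v)
    color : Fin n → Fin c
    color v = fromℕ< (∈-Upto⁻ (All.lookup inT (proj₂ (covers v))))
    toℕ-color : ∀ v → toℕ (color v) ≡ toℕ (layer v)
    toℕ-color v = Fin.toℕ-fromℕ< _
    packing : PackingColoring G c color
    packing u v u≢v same near = indep (proj₂ (covers u)) (proj₂ (covers v)) (inj₁
      ( Fin.toℕ-injective (trans (≡.sym (toℕ-color u)) (trans (cong toℕ same) (toℕ-color v)))
      , u≢v , subst (λ k → Within G (suc k) u v) (toℕ-color u) near))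

  colorable⇒full : ∀ {c} → c ≤ n → PackingColorable G c → ∃ λ T → Stable (Pow G (Upto c)) T × length T ≡ n
  colorable⇒full {c} c≤n (color , packing) =
    map colored (allFin n) , (uT , inT , indep) , trans (length-map colored (allFin n)) (length-allFin n)
    where
    colored : Fin n → Fin n × Fin n
    colored v = v , Fin.inject≤ (color v) c≤n
    toℕ-layer : ∀ v → toℕ (Fin.inject≤ (color v) c≤n) ≡ toℕ (color v)
    toℕ-layer v = Fin.toℕ-inject≤ (color v) c≤n
    uT : Unique (map colored (allFin n))
    uT = Unique.map⁺ (cong proj₁) (Unique.allFin⁺ n)
    inT : All (λ x → proj₂ x ∈ₛ Upto c) (map colored (allFin n))
    inT = All.map⁺ (All.tabulate λ {v} _ → ∈-Upto⁺ (subst (_< c) (≡.sym (toℕ-layer v)) (Fin.toℕ<n (color v))))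
    indep : ∀ {x y} → x ∈ map colored (allFin n) → y ∈ map colored (allFin n) → ¬ PowAdj G x y
    indep x∈ y∈ adj with ∈-map⁻ colored x∈ | ∈-map⁻ colored y∈
    ... | u , _ , refl | v , _ , refl with adj
    ...   | inj₁ (same , u≢v , near) = packing u v u≢v
              (Fin.toℕ-injective (trans (≡.sym (toℕ-layer u)) (trans (cong toℕ same) (toℕ-layer v))))
              (subst (λ k → Within G (suc k) u v) (toℕ-layer u) near)
    ...   | inj₂ (refl , i≢i) = i≢i refl

  αˢ-formula : ∀ {p} → 1 ≤ p → p ≤ n →
      (∃ λ t → 1 ≤ t × t ≤ p × ∃ λ b → IsAlpha (Pow G (Upto t)) b × αˢ p ≡ b + p ∸ t)
    × (∀ t → 1 ≤ t → t ≤ p → ∀ b → IsAlpha (Pow G (Upto t)) b → b + p ∸ t ≤ αˢ p)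
  αˢ-formula {p} 1≤p p≤n with αˢ-IsMaxShift 1≤p p≤n
  ... | (t , 1≤t , t≤p , αˢp≡) , at-most =
      (t , 1≤t , t≤p , αᴾ t , αᴾ-isAlpha t , αˢp≡)
    , λ t 1≤t t≤p b α≡b →
        subst (λ b → b + p ∸ t ≤ αˢ p) (IsAlpha-unique (αᴾ-isAlpha t) α≡b) (at-most t 1≤t t≤p)

  -- Pad a maximum stable set of G^[s] with one new layer per uncovered vertex.
  colorable-αᴾ : ∀ s → s + (n ∸ αᴾ s) ≤ n → PackingColorable G (s + (n ∸ αᴾ s))
  colorable-αᴾ s s+k≤n with proj₁ (αᴾ-isAlpha s)
  ... | T , st , ∣T∣≡αᴾs = full⇒colorable (proj₁ (proj₂ padded)) (trans (proj₂ (proj₂ padded)) ∣T∣+k≡n)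
    where
    ∣T∣+k≡n : length T + (n ∸ αᴾ s) ≡ n
    ∣T∣+k≡n = trans (cong (_+ (n ∸ αᴾ s)) ∣T∣≡αᴾs) (m+[n∸m]≡n (αᴾ≤n s))
    padded : ∃ λ T′ → Stable (Pow G (Upto (s + (n ∸ αᴾ s)))) T′ × length T′ ≡ length T + (n ∸ αᴾ s)
    padded = Stable-Pow-extend* (n ∸ αᴾ s) s+k≤n (≤-reflexive ∣T∣+k≡n) st

  IsPackingChromatic-αˢ : ∀ {p t₀} → 1 ≤ p → p ≤ n → 1 ≤ t₀ → t₀ ≤ p → αᴾ t₀ ≡ n →
                          IsPackingChromatic G (n + p ∸ αˢ p)
  IsPackingChromatic-αˢ {p} {t₀} 1≤p p≤n 1≤t₀ t₀≤p αᴾt₀≡n = colorable , minimal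
    where
    max-shift : IsMaxShift αᴾ p (αˢ p)
    max-shift = αˢ-IsMaxShift 1≤p p≤n
    c : ℕ
    c = n + p ∸ αˢ p
    c≤full-layer : ∀ {t} → 1 ≤ t → t ≤ p → n ≤ αᴾ t → c ≤ t
    c≤full-layer {t} 1≤t t≤p n≤αᴾt = m∸n≤o⇒m∸o≤n (n + p) t (αˢ p)
      (≤-trans (∸-monoˡ-≤ t (+-monoˡ-≤ p n≤αᴾt)) (proj₂ max-shift t 1≤t t≤p))
    c≤t₀ : c ≤ t₀
    c≤t₀ = c≤full-layer 1≤t₀ t₀≤p (≤-reflexive (≡.sym αᴾt₀≡n))
    colorable : PackingColorable G c
    colorable with proj₁ max-shift
    ... | s , _ , s≤p , αˢp≡ = subst (PackingColorable G) (≡.sym c≡s+k) (colorable-αᴾ s s+k≤n)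
      where
      k : ℕ
      k = n ∸ αᴾ s
      c≡s+k : c ≡ s + k
      c≡s+k = trans (cong (n + p ∸_) αˢp≡) (+-∸-complement (αᴾ≤n s) s≤p)
      s+k≤n : s + k ≤ n
      s+k≤n = subst (_≤ n) c≡s+k (≤-trans c≤t₀ (≤-trans t₀≤p p≤n))
    minimal : ∀ j → PackingColorable G j → c ≤ j
    minimal j colorable-j with p ≤? j
    ... | yes p≤j = ≤-trans c≤t₀ (≤-trans t₀≤p p≤j)
    ... | no p≰j  = c≤full-layer 1≤j j≤p n≤αᴾj
      where
      j≤p : j ≤ p
      j≤p = <⇒≤ (≰⇒> p≰j)
      1≤j : 1 ≤ j
      1≤j = ≤-<-trans z≤n (Fin.toℕ<n (proj₁ colorable-j (fromℕ< (≤-trans 1≤p p≤n))))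
      n≤αᴾj : n ≤ αᴾ j
      n≤αᴾj with colorable⇒full (≤-trans j≤p p≤n) colorable-j
      ... | T , st , ∣T∣≡n = subst (_≤ αᴾ j) ∣T∣≡n (proj₂ (αᴾ-isAlpha j) T st)

lemma4 : ∀ {n} (G : Graph n) → Connected G → DiamAtLeast2 G →
    ((F : Subset n) →
      (∀ S → MaxStable (Star G F) S →
         ∃ λ S* → MaxStable (Star G F) S* × LargestOf F ∣ K S ∣ (K S*))
      × ((∃ λ a → IsAlpha (Pow G F) a × a < n) →
           (∃ λ S → MaxStable (Star G F) S × (∀ i → ¬ ((nothing , i) ∈ S)))
           × (∃ λ a → IsAlpha (Star G F) a × IsAlpha (Pow G F) a)))
    × ((p : ℕ) → 1 ≤ p → p ≤ n →
      (∃ λ a → IsAlpha (Star G (Upto p)) a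
         × (∃ λ t → 1 ≤ t × t ≤ p × ∃ λ b → IsAlpha (Pow G (Upto t)) b × a ≡ b + p ∸ t)
         × (∀ t → 1 ≤ t → t ≤ p → ∀ b → IsAlpha (Pow G (Upto t)) b → b + p ∸ t ≤ a))
      × ((∃ λ t → 1 ≤ t × t ≤ p × IsAlpha (Pow G (Upto t)) n) →
           ∃ λ a → IsAlpha (Star G (Upto p)) a × IsPackingChromatic G (n + p ∸ a)))
lemma4 G _ _ =
    (λ F → MaxStable-largest-stars , λ (a , α≡a , a<n) →
       starless-MaxStable α≡a a<n , a , IsAlpha-Star α≡a a<n , α≡a)
  , λ p 1≤p p≤n →
        (αˢ G p , αˢ-isAlpha G p , αˢ-formula G 1≤p p≤n)
      , λ (t₀ , 1≤t₀ , t₀≤p , α≡n) → αˢ G p , αˢ-isAlpha G p ,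
          IsPackingChromatic-αˢ G 1≤p p≤n 1≤t₀ t₀≤p (IsAlpha-unique (αᴾ-isAlpha G t₀) α≡n)
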